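{- Let $n$ be even. Then there is no transversal in any latin square of order $n$ which agrees with $B_n$ outside of some set of $\lfloor\sqrt{n}\rfloor$ consecutive rows.
   Context: $B_n$ denotes the addition table of the integers modulo $n$: the latin square with rows, columns and symbols indexed by $N_n=\{0,\dots,n-1\}$ whose $(i,j)$ entry is $i+j \bmod n$. A transversal of a latin square of order $n$ is a set of $n$ cells, one in each row and each column, containing each symbol exactly once. -}

module Defs where

open import Data.Nat using (ℕ; _+_; _*_; _<_; _≤_; NonZero)
open import Data.Nat.DivMod using (_%_)
open import Data.Fin using (Fin; toℕ)
open import Data.Product using (Σ; ∃; _×_; _,_)
open import Function.Definitions using (Injective)
open import Relation.Binary.PropositionalEquality using (_≡_)
import Data.Empty
import Data.Fin
import Data.Nat.DivMod

-- A latin square of order n: rows, columns, symbols indexed by Fin n = N_n.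
-- Each symbol occurs at most (hence exactly) once in every row and column.
Square : ℕ → Set
Square n = Fin n → Fin n → Fin n

IsLatin : ∀ {n} → Square n → Set
IsLatin {n} L =
  (∀ r → Injective _≡_ _≡_ (λ c → L r c)) ×
  (∀ c → Injective _≡_ _≡_ (λ r → L r c))

B : ∀ n → .{{_ : NonZero n}} → Square n
B n i j = Data.Fin.fromℕ< (Data.Nat.DivMod.m%n<n (toℕ i + toℕ j) n)

-- A transversal: cells (i , σ i) with σ a permutation of the columns
-- (σ injective) and the symbols L i (σ i) pairwise distinct.
IsTransversal : ∀ {n} → Square n → (Fin n → Fin n) → Set
IsTransversal L σ = Injective _≡_ _≡_ σ × Injective _≡_ _≡_ (λ i → L i (σ i))

IsFloorSqrt : ℕ → ℕ → Set
IsFloorSqrt k n = k * k ≤ n × n < (1 + k) * (1 + k)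

InBlock : ∀ n → .{{_ : NonZero n}} → ℕ → ℕ → Fin n → Set
InBlock n a k r = Σ ℕ λ t → t < k × toℕ r ≡ (a + t) % n

AgreesOutside : ∀ {n} → .{{_ : NonZero n}} → Square n → Square n → ℕ → ℕ → Set
AgreesOutside {n} L M a k =
  ∀ r c → (InBlock n a k r → Data.Empty.⊥) → L r c ≡ M r c

module Submission where

-- Let n = 2h, let k ≤ n be the block length (k = ⌊√n⌋), and let
-- σ be a transversal of a latin square L that agrees with B_n outside the
-- k consecutive rows a, a+1, …, a+k-1 (mod n).  Measure every row i by its
-- offset  off i = i - a  and by its gap  gap i = L(i,σ i) - σ i - a  (mod n).
--   * Outside the block L(i,c) = i + c, so gap i = off i.
--   * Inside the block gap i < k: otherwise the row r = L(i,σ i) - σ i lies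
--     outside the block and L(r,σ i) = L(i,σ i), contradicting latinity.
-- Since the offsets run through 0, …, n-1 exactly once, the gap sum S lies
-- within K = k(k-1)/2 of T = n(n-1)/2 (replace the block offsets 0..k-1 by
-- values in 0..k-1).  On the other hand S ≡ Σ symbols - Σ columns ≡ 0 (mod n).
-- But T + h = h·n, so T is at distance h > K from every multiple of n.

open import Defs
open import Data.Nat using (ℕ; suc; _*_; _<_)
open import Data.Fin using (Fin)
open import Data.Product using (_×_)
open import Relation.Nullary using (¬_)
open import Relation.Binary.PropositionalEquality using (_≡_)

open import Data.Nat using (zero; pred; NonZero; _+_; _∸_; _≤_; z≤n; z<s; s≤s⁻¹; _<?_)
open import Data.Nat.Properties
open import Data.Nat.DivMod using (_%_; m%n<n; m%n%n≡m%n; [m+n]%n≡m%n; %-distribˡ-+; m<n⇒m%n≡m; m*n%n≡0)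
open import Data.Nat.Divisibility using (_∣_; divides; m%n≡0⇒n∣m)
open import Data.Nat.Tactic.RingSolver using (solve-∀)
open import Data.Fin using (zero; suc; toℕ; fromℕ<; punchOut)
open import Data.Fin.Properties using (toℕ-injective; toℕ-fromℕ<; toℕ<n; any?; injective⇒≤; punchOut-injective)
import Data.Fin.Properties as Fin
open import Data.Fin.Permutation using (Permutation; permutation)
open import Data.Bool using (if_then_else_)
open import Data.Product using (∃; _,_; proj₁; proj₂)
open import Relation.Nullary using (yes; no; contradiction)
open import Relation.Nullary.Decidable using (⌊_⌋)
open import Relation.Binary.PropositionalEquality using (refl; sym; trans; cong; cong₂; subst; _≢_; module ≡-Reasoning)
open import Function.Base using (case_of_)
open import Function.Definitions using (Injective)
open import Algebra.Properties.CommutativeMonoid.Sum +-0-commutativeMonoid using (sum; sum-permute; sum-cong-≗; ∑-distrib-+)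

injective⇒surjective : ∀ {n} (f : Fin n → Fin n) → Injective _≡_ _≡_ f → ∀ j → ∃ λ i → f i ≡ j
injective⇒surjective {zero} f inj ()
injective⇒surjective {suc n} f inj j with any? (λ i → f i Fin.≟ j)
... | yes found = found
... | no missed = contradiction (injective⇒≤ squeezed-injective) (<-irrefl refl)
  where
  -- if j is never hit, f squeezes Fin (suc n) injectively into Fin n
  unhit : ∀ i → j ≢ f i
  unhit i j≡fi = missed (i , sym j≡fi)
  squeezed : Fin (suc n) → Fin n
  squeezed i = punchOut (unhit i)
  squeezed-injective : Injective _≡_ _≡_ squeezed
  squeezed-injective {x} {y} eq = inj (punchOut-injective (unhit x) (unhit y) eq)

sum-reindex : ∀ {n} (f : Fin n → Fin n) → Injective _≡_ _≡_ f → (g : Fin n → ℕ) →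
              sum (λ i → g (f i)) ≡ sum g
sum-reindex f inj g = sym (sum-permute g π)
  where
  f⁻¹ : Fin _ → Fin _
  f⁻¹ j = proj₁ (injective⇒surjective f inj j)
  π : Permutation _ _
  π = permutation f f⁻¹ (λ j → proj₂ (injective⇒surjective f inj j))
                        (λ i → inj (proj₂ (injective⇒surjective f inj (f i))))

sum-mono : ∀ {n} {f g : Fin n → ℕ} → (∀ i → f i ≤ g i) → sum f ≤ sum g
sum-mono {zero} f≤g = z≤n
sum-mono {suc n} f≤g = +-mono-≤ (f≤g zero) (sum-mono (λ i → f≤g (suc i)))

sum-const : ∀ {n} c → sum (λ (_ : Fin n) → c) ≡ n * c
sum-const {zero} c = refl
sum-const {suc n} c = cong (c +_) (sum-const {n} c)

-- For injective (hence bijective) f, g on Fin n, Σ_i (f i + (n - g i)) = n·n,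
-- since f and g both enumerate 0, …, n-1.
sum-balance : ∀ {n} (f g : Fin n → Fin n) → Injective _≡_ _≡_ f → Injective _≡_ _≡_ g →
              sum (λ i → toℕ (f i) + (n ∸ toℕ (g i))) ≡ n * n
sum-balance {n} f g f-inj g-inj = begin
  sum (λ i → toℕ (f i) + (n ∸ toℕ (g i)))
    ≡⟨ ∑-distrib-+ (λ i → toℕ (f i)) (λ i → n ∸ toℕ (g i)) ⟩
  sum (λ i → toℕ (f i)) + sum (λ i → n ∸ toℕ (g i))
    ≡⟨ cong (_+ sum (λ i → n ∸ toℕ (g i))) f-to-g ⟩
  sum (λ i → toℕ (g i)) + sum (λ i → n ∸ toℕ (g i))
    ≡⟨ ∑-distrib-+ (λ i → toℕ (g i)) (λ i → n ∸ toℕ (g i)) ⟨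
  sum (λ i → toℕ (g i) + (n ∸ toℕ (g i)))
    ≡⟨ sum-cong-≗ (λ i → m+[n∸m]≡n (<⇒≤ (toℕ<n (g i)))) ⟩
  sum (λ (_ : Fin n) → n)
    ≡⟨ sum-const {n} n ⟩
  n * n ∎
  where
  open ≡-Reasoning
  f-to-g : sum (λ i → toℕ (f i)) ≡ sum (λ i → toℕ (g i))
  f-to-g = trans (sum-reindex f f-inj toℕ) (sym (sum-reindex g g-inj toℕ))

%-absorbˡ : ∀ x y N .{{_ : NonZero N}} → (x % N + y) % N ≡ (x + y) % N
%-absorbˡ x y N = begin
  (x % N + y) % N          ≡⟨ %-distribˡ-+ (x % N) y N ⟩
  (x % N % N + y % N) % N  ≡⟨ cong (λ z → (z + y % N) % N) (m%n%n≡m%n x N) ⟩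
  (x % N + y % N) % N      ≡⟨ %-distribˡ-+ x y N ⟨
  (x + y) % N              ∎
  where open ≡-Reasoning

%-absorbʳ : ∀ x y N .{{_ : NonZero N}} → (x + y % N) % N ≡ (x + y) % N
%-absorbʳ x y N = begin
  (x + y % N) % N  ≡⟨ cong (_% N) (+-comm x (y % N)) ⟩
  (y % N + x) % N  ≡⟨ %-absorbˡ y x N ⟩
  (y + x) % N      ≡⟨ cong (_% N) (+-comm y x) ⟩
  (x + y) % N      ∎
  where open ≡-Reasoning

sum-% : ∀ N .{{_ : NonZero N}} {n} (f : Fin n → ℕ) → sum (λ i → f i % N) % N ≡ sum f % N
sum-% N {zero} f = refl
sum-% N {suc n} f = begin
  (f zero % N + rest′) % N     ≡⟨ %-absorbˡ (f zero) rest′ N ⟩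
  (f zero + rest′) % N         ≡⟨ %-absorbʳ (f zero) rest′ N ⟨
  (f zero + rest′ % N) % N     ≡⟨ cong (λ z → (f zero + z) % N) (sum-% N (λ i → f (suc i))) ⟩
  (f zero + rest % N) % N      ≡⟨ %-absorbʳ (f zero) rest N ⟩
  (f zero + rest) % N          ∎
  where
  open ≡-Reasoning
  rest′ = sum (λ i → f (suc i) % N)
  rest = sum (λ i → f (suc i))

rsum : ℕ → (ℕ → ℕ) → ℕ
rsum n f = sum (λ (i : Fin n) → f (toℕ i))

rsum-cong : ∀ n {f g : ℕ → ℕ} → (∀ j → j < n → f j ≡ g j) → rsum n f ≡ rsum n g
rsum-cong n f≡g = sum-cong-≗ (λ i → f≡g (toℕ i) (toℕ<n i))

rsum-split : ∀ k m f → rsum (k + m) f ≡ rsum k f + rsum m (λ j → f (k + j))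
rsum-split zero m f = refl
rsum-split (suc k) m f = begin
  f 0 + rsum (k + m) (λ j → f (suc j))
    ≡⟨ cong (f 0 +_) (rsum-split k m (λ j → f (suc j))) ⟩
  f 0 + (rsum k (λ j → f (suc j)) + rsum m (λ j → f (suc (k + j))))
    ≡⟨ +-assoc (f 0) _ _ ⟨
  rsum (suc k) f + rsum m (λ j → f (suc k + j)) ∎
  where open ≡-Reasoning

tri : ℕ → ℕ
tri n = rsum n (λ j → j)

tri-suc : ∀ n → tri (suc n) ≡ n + tri n
tri-suc n = begin
  rsum n (λ j → 1 + j)             ≡⟨ ∑-distrib-+ {n} (λ _ → 1) toℕ ⟩
  sum (λ (_ : Fin n) → 1) + tri n  ≡⟨ cong (_+ tri n) (trans (sum-const {n} 1) (*-identityʳ n)) ⟩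
  n + tri n                        ∎
  where open ≡-Reasoning

triangle : ∀ n → 2 * tri n ≡ n * pred n
triangle zero = refl
triangle (suc n) = begin
  2 * tri (suc n)        ≡⟨ cong (2 *_) (tri-suc n) ⟩
  2 * (n + tri n)        ≡⟨ *-distribˡ-+ 2 n (tri n) ⟩
  2 * n + 2 * tri n      ≡⟨ cong (2 * n +_) (triangle n) ⟩
  2 * n + n * pred n     ≡⟨ step n ⟩
  suc n * n              ∎
  where
  open ≡-Reasoning
  step : ∀ n → 2 * n + n * pred n ≡ suc n * n
  step zero = refl
  step (suc n) = step-suc n
    where
    step-suc : ∀ n → 2 * suc n + suc n * n ≡ suc (suc n) * suc n
    step-suc = solve-∀

flatten : ℕ → ℕ → ℕ → ℕ
flatten k c j = if ⌊ j <? k ⌋ then c else j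

flatten-below : ∀ {k c j} → j < k → flatten k c j ≡ c
flatten-below {k} {c} {j} j<k with j <? k
... | yes _ = refl
... | no j≮k = contradiction j<k j≮k

flatten-above : ∀ {k c j} → ¬ j < k → flatten k c j ≡ j
flatten-above {k} {c} {j} j≮k with j <? k
... | yes j<k = contradiction j<k j≮k
... | no _ = refl

rsum-flatten : ∀ {k n} c → k ≤ n → rsum n (flatten k c) + tri k ≡ tri n + k * c
rsum-flatten {k} c k≤n with m≤n⇒∃[o]m+o≡n k≤n
... | m , refl = begin
  rsum (k + m) (flatten k c) + tri k
    ≡⟨ cong (_+ tri k) (rsum-split k m (flatten k c)) ⟩
  rsum k (flatten k c) + rsum m (λ j → flatten k c (k + j)) + tri k
    ≡⟨ cong (λ z → z + tri k) (cong₂ _+_ low high) ⟩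
  k * c + rsum m (k +_) + tri k
    ≡⟨ rearrange (k * c) (rsum m (k +_)) (tri k) ⟩
  tri k + rsum m (k +_) + k * c
    ≡⟨ cong (_+ k * c) (rsum-split k m (λ j → j)) ⟨
  tri (k + m) + k * c ∎
  where
  open ≡-Reasoning
  low : rsum k (flatten k c) ≡ k * c
  low = trans (rsum-cong k (λ j j<k → flatten-below j<k)) (sum-const {k} c)
  high : rsum m (λ j → flatten k c (k + j)) ≡ rsum m (k +_)
  high = rsum-cong m (λ j _ → flatten-above (λ k+j<k → <-irrefl refl (≤-<-trans (m≤m+n k j) k+j<k)))
  rearrange : ∀ a b t → a + b + t ≡ t + b + a
  rearrange = solve-∀

-- If T + h = h·N with N = 2h, then T is at distance exactly h from the
-- nearest multiples (h-1)·N and h·N, so no multiple of N is closer than h.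
far-from-multiples : ∀ {N h T S} → N ≡ 2 * h → T + h ≡ h * N →
                     T < S + h → S < T + h → ¬ N ∣ S
far-from-multiples {N} {h} {T} N≡2h T+h≡hN T<S+h S<T+h (divides q refl) =
  <-irrefl refl (<-≤-trans q<h h≤q)
  where
  q<h : q < h
  q<h = *-cancelʳ-< N q h (<-≤-trans S<T+h (≤-reflexive T+h≡hN))
  h≤q : h ≤ q
  h≤q = s≤s⁻¹ (*-cancelʳ-< N h (suc q) (begin-strict
    h * N          ≡⟨ T+h≡hN ⟨
    T + h          <⟨ +-monoˡ-< h T<S+h ⟩
    q * N + h + h  ≡⟨ +-assoc (q * N) h h ⟩
    q * N + (h + h) ≡⟨ cong (λ z → q * N + z) (trans (cong (h +_) (sym (+-identityʳ h))) (sym N≡2h)) ⟩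
    q * N + N      ≡⟨ +-comm (q * N) N ⟩
    suc q * N      ∎))
    where open ≤-Reasoning

triangle-even : ∀ m h → suc m ≡ 2 * h → tri (suc m) + h ≡ h * suc m
triangle-even m h n≡2h = *-cancelˡ-≡ (tri (suc m) + h) (h * suc m) 2 (begin
  2 * (tri (suc m) + h)        ≡⟨ *-distribˡ-+ 2 (tri (suc m)) h ⟩
  2 * tri (suc m) + 2 * h      ≡⟨ cong₂ _+_ (triangle (suc m)) (sym n≡2h) ⟩
  suc m * m + suc m            ≡⟨ trans (+-comm (suc m * m) (suc m)) (sym (*-suc (suc m) m)) ⟩
  suc m * suc m                ≡⟨ cong (_* suc m) n≡2h ⟩
  2 * h * suc m                ≡⟨ *-assoc 2 h (suc m) ⟩
  2 * (h * suc m)              ∎)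
  where open ≡-Reasoning

square-bound : ∀ {k N} → k * k ≤ N → k ≤ N
square-bound {zero} _ = z≤n
square-bound {suc k} k²≤N = ≤-trans (m≤m*n (suc k) (suc k)) k²≤N

block-weight : ∀ {k N} → k * k ≤ N → 0 < N → 2 * tri k < N
block-weight {zero} _ 0<N = 0<N
block-weight {suc k} k²≤N _ = begin-strict
  2 * tri (suc k)  ≡⟨ triangle (suc k) ⟩
  suc k * k        <⟨ *-monoʳ-< (suc k) (n<1+n k) ⟩
  suc k * suc k    ≤⟨ k²≤N ⟩
  _                ∎
  where open ≤-Reasoning

module Residues (n : ℕ) .{{_ : NonZero n}} where

  infixl 6 _⊖_
  -- x - y modulo n (for y ≤ n)
  _⊖_ : ℕ → ℕ → ℕ
  x ⊖ y = (x + (n ∸ y)) % n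

  ⊖<n : ∀ x y → x ⊖ y < n
  ⊖<n x y = m%n<n (x + (n ∸ y)) n

  ⊖-+ : ∀ x {y} → y ≤ n → (x ⊖ y + y) % n ≡ x % n
  ⊖-+ x {y} y≤n = begin
    ((x + (n ∸ y)) % n + y) % n  ≡⟨ %-absorbˡ (x + (n ∸ y)) y n ⟩
    (x + (n ∸ y) + y) % n        ≡⟨ cong (_% n) (trans (+-assoc x (n ∸ y) y) (cong (x +_) (m∸n+n≡m y≤n))) ⟩
    (x + n) % n                  ≡⟨ [m+n]%n≡m%n x n ⟩
    x % n                        ∎
    where open ≡-Reasoning

  +-⊖ : ∀ x {y} → y ≤ n → (x + y) % n ⊖ y ≡ x % n
  +-⊖ x {y} y≤n = begin
    ((x + y) % n + (n ∸ y)) % n  ≡⟨ %-absorbˡ (x + y) (n ∸ y) n ⟩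
    (x + y + (n ∸ y)) % n        ≡⟨ cong (_% n) (trans (+-assoc x y (n ∸ y)) (cong (x +_) (m+[n∸m]≡n y≤n))) ⟩
    (x + n) % n                  ≡⟨ [m+n]%n≡m%n x n ⟩
    x % n                        ∎
    where open ≡-Reasoning

  residue : ℕ → Fin n
  residue x = fromℕ< (m%n<n x n)

module Gaps (n : ℕ) .{{_ : NonZero n}} (a k : ℕ) (a≤n : a ≤ n) (k≤n : k ≤ n)
            (L : Square n) (L-latin : IsLatin L) (agrees : AgreesOutside L (B n) a k)
            (σ : Fin n → Fin n) (σ-transversal : IsTransversal L σ) where

  open Residues n

  off : Fin n → ℕ
  off i = toℕ i ⊖ a

  -- symbol minus column minus a; it equals off i wherever L agrees with B_n
  gap : Fin n → ℕ
  gap i = toℕ (L i (σ i)) ⊖ toℕ (σ i) ⊖ a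

  block-offset : ∀ r → InBlock n a k r → off r < k
  block-offset r (t , t<k , r≡a+t) = subst (_< k) (sym off≡t) t<k
    where
    open ≡-Reasoning
    off≡t : off r ≡ t
    off≡t = begin
      toℕ r ⊖ a        ≡⟨ cong (_⊖ a) (trans r≡a+t (cong (_% n) (+-comm a t))) ⟩
      (t + a) % n ⊖ a  ≡⟨ +-⊖ t a≤n ⟩
      t % n            ≡⟨ m<n⇒m%n≡m (<-≤-trans t<k k≤n) ⟩
      t                ∎

  agrees-off : ∀ r c → ¬ off r < k → toℕ (L r c) ≡ (toℕ r + toℕ c) % n
  agrees-off r c r-outside =
    trans (cong toℕ (agrees r c (λ r-inside → r-outside (block-offset r r-inside))))
          (toℕ-fromℕ< _)

  -- outside the block, symbol - column = row, so the gap is the offset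
  gap-outside : ∀ i → ¬ off i < k → gap i ≡ off i
  gap-outside i i-outside = cong (_⊖ a) (begin
    toℕ (L i c) ⊖ toℕ c             ≡⟨ cong (_⊖ toℕ c) (agrees-off i c i-outside) ⟩
    (toℕ i + toℕ c) % n ⊖ toℕ c     ≡⟨ +-⊖ (toℕ i) (<⇒≤ (toℕ<n c)) ⟩
    toℕ i % n                       ≡⟨ m<n⇒m%n≡m (toℕ<n i) ⟩
    toℕ i                           ∎)
    where
    open ≡-Reasoning
    c = σ i

  -- Latinity: if gap i ≥ k, the row r = symbol - column lies outside the block
  -- and carries the same symbol in column σ i, so r = i and i is outside too.
  large-gap⇒outside : ∀ i → ¬ gap i < k → ¬ off i < k
  large-gap⇒outside i large = subst (λ x → ¬ off x < k) r≡i r-outside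
    where
    open ≡-Reasoning
    c = σ i
    s = toℕ (L i c)
    r = residue (s ⊖ toℕ c)
    toℕ-r : toℕ r ≡ s ⊖ toℕ c
    toℕ-r = trans (toℕ-fromℕ< _) (m%n%n≡m%n (s + (n ∸ toℕ c)) n)
    r-outside : ¬ off r < k
    r-outside = subst (λ x → ¬ x < k) (sym (cong (_⊖ a) toℕ-r)) large
    same-symbol : toℕ (L r c) ≡ s
    same-symbol = begin
      toℕ (L r c)                 ≡⟨ agrees-off r c r-outside ⟩
      (toℕ r + toℕ c) % n         ≡⟨ cong (λ x → (x + toℕ c) % n) toℕ-r ⟩
      (s ⊖ toℕ c + toℕ c) % n     ≡⟨ ⊖-+ s (<⇒≤ (toℕ<n c)) ⟩
      s % n                       ≡⟨ m<n⇒m%n≡m (toℕ<n (L i c)) ⟩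
      s                           ∎
    r≡i : r ≡ i
    r≡i = proj₂ L-latin c (toℕ-injective same-symbol)

  gap-inside : ∀ i → off i < k → gap i < k
  gap-inside i i-inside with gap i <? k
  ... | yes small = small
  ... | no large = contradiction i-inside (large-gap⇒outside i large)

  gap-lower : ∀ i → flatten k 0 (off i) ≤ gap i
  gap-lower i = case off i <? k of λ where
    (yes inside) → ≤-trans (≤-reflexive (flatten-below inside)) z≤n
    (no outside) → ≤-reflexive (trans (flatten-above outside) (sym (gap-outside i outside)))

  gap-upper : ∀ i → gap i ≤ flatten k (pred k) (off i)
  gap-upper i = case off i <? k of λ where
    (yes inside) → ≤-trans (<⇒≤pred (gap-inside i inside)) (≤-reflexive (sym (flatten-below inside)))
    (no outside) → ≤-reflexive (trans (gap-outside i outside) (sym (flatten-above outside)))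

  rotate : Fin n → Fin n
  rotate i = fromℕ< (⊖<n (toℕ i) a)

  rotate-injective : Injective _≡_ _≡_ rotate
  rotate-injective {x} {y} eq = toℕ-injective (begin
    toℕ x                ≡⟨ recover x ⟨
    (off x + a) % n      ≡⟨ cong (λ z → (z + a) % n) same-offset ⟩
    (off y + a) % n      ≡⟨ recover y ⟩
    toℕ y                ∎)
    where
    open ≡-Reasoning
    recover : ∀ i → (off i + a) % n ≡ toℕ i
    recover i = trans (⊖-+ (toℕ i) a≤n) (m<n⇒m%n≡m (toℕ<n i))
    same-offset : off x ≡ off y
    same-offset = trans (sym (toℕ-fromℕ< _)) (trans (cong toℕ eq) (toℕ-fromℕ< _))

  sum-by-offset : ∀ g → sum (λ i → g (off i)) ≡ rsum n g
  sum-by-offset g = trans (sum-cong-≗ {n} (λ i → cong g (sym (toℕ-fromℕ< _))))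
                          (sum-reindex rotate rotate-injective (λ j → g (toℕ j)))

  gap-sum-lower : tri n ≤ sum gap + tri k
  gap-sum-lower = begin
    tri n                                 ≡⟨ trans (cong (tri n +_) (*-zeroʳ k)) (+-identityʳ (tri n)) ⟨
    tri n + k * 0                         ≡⟨ rsum-flatten 0 k≤n ⟨
    rsum n (flatten k 0) + tri k          ≡⟨ cong (_+ tri k) (sum-by-offset (flatten k 0)) ⟨
    sum (λ i → flatten k 0 (off i)) + tri k ≤⟨ +-monoˡ-≤ (tri k) (sum-mono gap-lower) ⟩
    sum gap + tri k                       ∎
    where open ≤-Reasoning

  gap-sum-upper : sum gap ≤ tri n + tri k
  gap-sum-upper = +-cancelʳ-≤ (tri k) (sum gap) (tri n + tri k) (begin
    sum gap + tri k                              ≤⟨ +-monoˡ-≤ (tri k) (sum-mono gap-upper) ⟩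
    sum (λ i → flatten k (pred k) (off i)) + tri k ≡⟨ cong (_+ tri k) (sum-by-offset (flatten k (pred k))) ⟩
    rsum n (flatten k (pred k)) + tri k          ≡⟨ rsum-flatten (pred k) k≤n ⟩
    tri n + k * pred k                           ≡⟨ cong (tri n +_) (sym (triangle k)) ⟩
    tri n + 2 * tri k                            ≡⟨ cong (tri n +_) (cong (tri k +_) (+-identityʳ (tri k))) ⟩
    tri n + (tri k + tri k)                      ≡⟨ +-assoc (tri n) (tri k) (tri k) ⟨
    tri n + tri k + tri k                        ∎)
    where open ≤-Reasoning

  -- Σ gap ≡ Σ symbols - Σ columns - n·a ≡ 0 (mod n).
  gap-sum-divisible : n ∣ sum gap
  gap-sum-divisible = m%n≡0⇒n∣m (sum gap) n (begin
    sum gap % n                  ≡⟨ cong (_% n) (sum-cong-≗ gap≡X%n) ⟩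
    sum (λ i → X i % n) % n      ≡⟨ sum-% n X ⟩
    sum X % n                    ≡⟨ cong (_% n) sum-X ⟩
    (n + (n ∸ a)) * n % n        ≡⟨ m*n%n≡0 (n + (n ∸ a)) n ⟩
    0                            ∎)
    where
    open ≡-Reasoning
    X : Fin n → ℕ
    X i = toℕ (L i (σ i)) + (n ∸ toℕ (σ i)) + (n ∸ a)
    gap≡X%n : ∀ i → gap i ≡ X i % n
    gap≡X%n i = %-absorbˡ (toℕ (L i (σ i)) + (n ∸ toℕ (σ i))) (n ∸ a) n
    sum-X : sum X ≡ (n + (n ∸ a)) * n
    sum-X = begin
      sum X
        ≡⟨ ∑-distrib-+ (λ i → toℕ (L i (σ i)) + (n ∸ toℕ (σ i))) (λ _ → n ∸ a) ⟩
      sum (λ i → toℕ (L i (σ i)) + (n ∸ toℕ (σ i))) + sum (λ (_ : Fin n) → n ∸ a)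
        ≡⟨ cong₂ _+_ (sum-balance (λ i → L i (σ i)) σ (proj₂ σ-transversal) (proj₁ σ-transversal))
                     (sum-const {n} (n ∸ a)) ⟩
      n * n + n * (n ∸ a)
        ≡⟨ *-distribˡ-+ n n (n ∸ a) ⟨
      n * (n + (n ∸ a))
        ≡⟨ *-comm n (n + (n ∸ a)) ⟩
      (n + (n ∸ a)) * n ∎

corollary2p4 : (m : ℕ) → let n = suc m in (h : ℕ) → n ≡ 2 * h → (k : ℕ) → IsFloorSqrt k n → (a : ℕ) → a < n → (L : Square n) → IsLatin L → AgreesOutside L (B n) a k → (σ : Fin n → Fin n) → ¬ IsTransversal L σ
corollary2p4 m h n≡2h k (k²≤n , _) a a<n L L-latin agrees σ σ-transversal =
  far-from-multiples n≡2h (triangle-even m h n≡2h)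
    (≤-<-trans gap-sum-lower (+-monoʳ-< (sum gap) block<h))
    (≤-<-trans gap-sum-upper (+-monoʳ-< (tri (suc m)) block<h))
    gap-sum-divisible
  where
  open Gaps (suc m) a k (<⇒≤ a<n) (square-bound k²≤n) L L-latin agrees σ σ-transversal
  block<h : tri k < h
  block<h = *-cancelˡ-< 2 (tri k) h (subst (2 * tri k <_) n≡2h (block-weight {k} {suc m} k²≤n z<s))
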